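{- Let $H$ be a finite digraph possibly with loops, $D$ a finite $H$-colored digraph without loops and without isolated vertices, and $\xi=\{C_1,\dots,C_k\}$ ($k\ge2$) a partition of $V(H)$ such that for every $i$ the set $A_i=\{a\in A(D):c(a)\in C_i\}$ is nonempty and $G_i=D[A_i]$ is transitive by $H$-paths. Let $\{\xi_1,\xi_2\}$ be a partition of $\xi$ and, for $i\in\{1,2\}$, let $D_i$ be the spanning subdigraph of $D$ with $A(D_i)=\{a\in A(D):c(a)\in C_j\text{ for some }C_j\in\xi_i\}$. Suppose that (1) for each $i\in\{1,2\}$ and each $H$-walk $P$ contained in $D_i$ there exists $m'\in\{1,\dots,k\}$ such that $P$ is contained in $G_{m'}$, and (2) if $(a,b)\in A(\mathscr{C}_C(D))$ is a $\xi_1\xi_2$-arc or a $\xi_2\xi_1$-arc, then $(a,b)\notin A(H)$. Then every $H$-walk of $D$ is contained in $D_1$ or in $D_2$; moreover, for each $H$-walk $T$ of $D$ there exists $l\in\{1,\dots,k\}$ such that $T$ is contained in $G_l$.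
   Context: Walks are directed. $D$ is $H$-colored if it has an arc coloring $c:A(D)\to V(H)$. A walk $(v_0,\dots,v_n)$ is an $H$-walk if $(c(v_0,v_1),\dots,c(v_{n-1},v_n))$ is a walk in $H$ (a single arc is an $H$-walk); an $H$-path is a path (distinct vertices) that is an $H$-walk. $D[A]$ for an arc set $A$ is the subdigraph with arc set $A$ and vertex set the ends of arcs in $A$. A subdigraph $G$ is transitive by $H$-paths if an $xy$-$H$-path contained in $G$ and a $yz$-$H$-path contained in $G$ imply an $xz$-$H$-path contained in $G$. The color-class digraph $\mathscr{C}_C(D)$ has as vertices the colors appearing on arcs of $D$, with $(i,j)$ an arc (loops allowed) iff there are arcs $(u,v),(v,w)$ in $D$ colored $i$ and $j$ respectively. A $\xi_1\xi_2$-arc is an arc $(a,b)$ with $a$ in some member of $\xi_1$ and $b$ in some member of $\xi_2$; a $\xi_2\xi_1$-arc is defined symmetrically. -}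

module Defs where

open import Data.Nat using (ℕ; _≤_)
open import Data.Fin using (Fin)
open import Data.Bool using (Bool; true; false)
open import Data.Maybe using (just)
open import Data.List using (List; []; _∷_; length; head; last)
open import Data.List.Relation.Unary.Linked using (Linked)
open import Data.List.Relation.Unary.Unique.Propositional using (Unique)
open import Data.Product using (Σ; _×_; ∃-syntax)
open import Relation.Nullary using (¬_)
open import Relation.Binary.PropositionalEquality using (_≡_; _≢_)

-- An arc colouring of D by H is c : Fin n → Fin n → Fin h (only its values on arcs matter).

module _ {n h : ℕ} (HA : Fin h → Fin h → Set) (DA : Fin n → Fin n → Set)
         (c : Fin n → Fin n → Fin h) where

  arcColors : List (Fin n) → List (Fin h)
  arcColors []            = []
  arcColors (_ ∷ [])      = []
  arcColors (u ∷ v ∷ vs)  = c u v ∷ arcColors (v ∷ vs)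

  IsWalk : List (Fin n) → Set
  IsWalk p = (2 ≤ length p) × Linked DA p

  IsHWalk : List (Fin n) → Set
  IsHWalk p = IsWalk p × Linked HA (arcColors p)

  IsHPath : Fin n → Fin n → List (Fin n) → Set
  IsHPath x y p = IsHWalk p × Unique p × (head p ≡ just x) × (last p ≡ just y)

  -- a walk is contained in the subdigraph D[{a ∈ A(D) : P (c a)}] iff all its arcs have colour in P
  -- (its vertices are then automatically ends of such arcs)
  ArcsColoured : (Fin h → Set) → List (Fin n) → Set
  ArcsColoured P p = Linked (λ u v → P (c u v)) p

  TransitiveByHPaths : (Fin h → Set) → Set
  TransitiveByHPaths P = ∀ x y z p q →
    IsHPath x y p → ArcsColoured P p →
    IsHPath y z q → ArcsColoured P q →
    x ≢ z →
    ∃[ r ] (IsHPath x z r × ArcsColoured P r)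

  ColorClassArc : Fin h → Fin h → Set
  ColorClassArc i j = ∃[ u ] ∃[ v ] ∃[ w ] (DA u v × DA v w × c u v ≡ i × c v w ≡ j)

module Submission where

open import Defs
open import Data.Nat using (ℕ; _≥_; s≤s)
open import Data.Fin using (Fin)
open import Data.Bool using (Bool; true; false)
import Data.Bool.Properties as Bool
open import Data.List using (List; []; _∷_)
open import Data.List.Relation.Unary.Linked as Linked using (Linked; [-]; _∷_)
open import Data.Product using (_×_; _,_; ∃-syntax)
open import Data.Sum using (_⊎_; inj₁; inj₂)
open import Function using (_∘_)
open import Relation.Binary.Definitions using (DecidableEquality)
open import Relation.Binary.PropositionalEquality using (_≡_; _≢_; refl; sym; trans)
open import Relation.Nullary using (¬_)
open import Relation.Nullary.Decidable using (decidable-stable)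

-- Hypothesis (2) says that an H-arc between consecutive colours of D never crosses the
-- partition {ξ₁, ξ₂}; hence along an H-walk the side of the colour class never changes, so
-- every H-walk lies in D₁ or in D₂, and hypothesis (1) then puts it inside a single G_l.

separated⇒equal : ∀ {A B : Set} {R Q : A → A → Set} (f : A → B) → DecidableEquality B →
  (∀ a b → R a b → f a ≢ f b → ¬ Q a b) →
  ∀ a b → R a b → Q a b → f a ≡ f b
separated⇒equal f _≟_ separated a b r q =
  decidable-stable (f a ≟ f b) (λ f-differ → separated a b r f-differ q)

module _ {n h : ℕ} {B : Set}
         (HA : Fin h → Fin h → Set) (DA : Fin n → Fin n → Set) (c : Fin n → Fin n → Fin h)
         (f : Fin h → B)
         (f-respects : ∀ a b → ColorClassArc HA DA c a b → HA a b → f a ≡ f b) where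

  arcsColoured-constant : ∀ u v vs → Linked DA (u ∷ v ∷ vs) →
    Linked HA (arcColors HA DA c (u ∷ v ∷ vs)) →
    ArcsColoured HA DA c (λ col → f col ≡ f (c u v)) (u ∷ v ∷ vs)
  arcsColoured-constant u v []       _          _         = refl ∷ [-]
  arcsColoured-constant u v (w ∷ ws) (uv ∷ vws) (H ∷ Hs) =
    refl ∷ Linked.map (λ e → trans e (sym same)) (arcsColoured-constant v w ws vws Hs)
    where
    same : f (c u v) ≡ f (c v w)
    same = f-respects _ _ (u , v , w , uv , Linked.head vws , refl , refl) H

  hWalk-constant : ∀ t → IsHWalk HA DA c t → ∃[ s ] ArcsColoured HA DA c (λ col → f col ≡ s) t
  hWalk-constant (_ ∷ [])     ((s≤s () , _) , _)
  hWalk-constant (u ∷ v ∷ vs) ((_ , arcs) , colours) = f (c u v) , arcsColoured-constant u v vs arcs colours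

mainTheorem9 :
    ∀ {n h k : ℕ}
      (HA : Fin h → Fin h → Set) (DA : Fin n → Fin n → Set) (c : Fin n → Fin n → Fin h)
      (part : Fin h → Fin k) (side : Fin k → Bool) →
    (∀ v → ¬ DA v v) →
    (∀ v → ∃[ u ] (DA v u ⊎ DA u v)) →
    k ≥ 2 →
    (∀ m → ∃[ u ] ∃[ v ] (DA u v × part (c u v) ≡ m)) →
    (∀ m → TransitiveByHPaths HA DA c (λ col → part col ≡ m)) →
    (∃[ m ] (side m ≡ false)) →
    (∃[ m ] (side m ≡ true)) →
    (∀ (s : Bool) (p : List (Fin n)) → IsHWalk HA DA c p →
       ArcsColoured HA DA c (λ col → side (part col) ≡ s) p →
       ∃[ m ] ArcsColoured HA DA c (λ col → part col ≡ m) p) →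
    (∀ a b → ColorClassArc HA DA c a b → side (part a) ≢ side (part b) → ¬ HA a b) →
    ∀ (t : List (Fin n)) → IsHWalk HA DA c t →
      (ArcsColoured HA DA c (λ col → side (part col) ≡ false) t
        ⊎ ArcsColoured HA DA c (λ col → side (part col) ≡ true) t)
      × ∃[ l ] ArcsColoured HA DA c (λ col → part col ≡ l) t
mainTheorem9 HA DA c part side _ _ _ _ _ _ _ withinOneSide noCrossing t walk
  with hWalk-constant HA DA c (side ∘ part)
         (separated⇒equal (side ∘ part) Bool._≟_ noCrossing) t walk
... | false , onFalse = inj₁ onFalse , withinOneSide false t walk onFalse
... | true  , onTrue  = inj₂ onTrue  , withinOneSide true  t walk onTrue
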